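{- Every finite simple connected closed graph is narrow.
   Context: A labeling of a graph $G$ with $n$ vertices is a bijection $V(G)\to[n]$, identified with $V(G)=[n]$. It is closed if whenever $\{j,i\},\{i,k\}$ are distinct edges with either ($j>i$ and $k>i$) or ($j<i$ and $k<i$), then $\{j,k\}\in E(G)$; a graph is closed if it has a closed labeling. For a connected graph, $d(v,w)$ is shortest-path distance, $\mathrm{diam}(G)=\max_{v,w}d(v,w)$, and a longest shortest path is a shortest path connecting two vertices at distance $\mathrm{diam}(G)$. A connected graph is narrow if for every vertex $v$ and every longest shortest path $P$, either $v\in V(P)$ or $v$ is adjacent to a vertex of $P$. -}

module Defs where

open import Data.Nat using (ℕ; zero; suc; _≤_)
open import Data.Fin using (Fin; _<_)
open import Data.Product using (Σ; ∃; _×_; _,_)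
open import Data.Sum using (_⊎_)
open import Relation.Nullary using (¬_; Dec)
open import Relation.Binary.PropositionalEquality using (_≡_; _≢_)
open import Function.Bundles using (_⤖_; Bijection)

record SimpleGraph (n : ℕ) : Set₁ where
  field
    Adj    : Fin n → Fin n → Set
    sym    : ∀ {u v} → Adj u v → Adj v u
    irrefl : ∀ {u} → ¬ Adj u u
    dec    : ∀ u v → Dec (Adj u v)

module _ {n : ℕ} (G : SimpleGraph n) where
  open SimpleGraph G

  data Walk : Fin n → Fin n → ℕ → Set where
    here : ∀ {u} → Walk u u zero
    step : ∀ {u w v k} → Adj u w → Walk w v k → Walk u v (suc k)

  data OnWalk (x : Fin n) : ∀ {u v k} → Walk u v k → Set where
    onHead : ∀ {v k} {p : Walk x v k} → OnWalk x p
    onTail : ∀ {u w v k} {a : Adj u w} {p : Walk w v k} →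
             OnWalk x p → OnWalk x (step a p)

  Connected : Set
  Connected = ∀ u v → ∃ λ k → Walk u v k

  Dist : Fin n → Fin n → ℕ → Set
  Dist u v k = Walk u v k × (∀ {m} → Walk u v m → k ≤ m)

  Diam : ℕ → Set
  Diam D = (∃ λ u → ∃ λ v → Dist u v D) × (∀ u v k → Dist u v k → k ≤ D)

  LongestShortestPath : ∀ {u v k} → Walk u v k → Set
  LongestShortestPath {u} {v} {k} P =
    (∀ {m} → Walk u v m → k ≤ m) × Diam k

  IsClosedLabeling : (Fin n ⤖ Fin n) → Set
  IsClosedLabeling σ = ∀ i j k → Adj j i → Adj i k → j ≢ k →
    ((ℓ i < ℓ j × ℓ i < ℓ k) ⊎ (ℓ j < ℓ i × ℓ k < ℓ i)) → Adj j k
    where ℓ = Bijection.to σ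

  IsClosed : Set
  IsClosed = ∃ λ (σ : Fin n ⤖ Fin n) → IsClosedLabeling σ

  Narrow : Set
  Narrow = ∀ (x : Fin n) {u v k} (P : Walk u v k) → LongestShortestPath P →
    OnWalk x P ⊎ (∃ λ y → OnWalk y P × Adj x y)

module Submission where

open import Defs
open import Data.Nat as ℕ using (ℕ; zero; suc; _≤_; s≤s; z≤n)
open import Data.Nat.Properties using (anyUpTo?; ≮⇒≥; ≤-pred; <-≤-trans; <⇒≱; 1+n≰n; n≤1+n; ≤-trans)
open import Data.Nat.Induction using (<-rec)
open import Data.Fin using (Fin; _≟_)
import Data.Fin as Fin
import Data.Fin.Properties as Fin
open import Data.Product using (∃; _×_; _,_; proj₂)
open import Data.Sum as Sum using (_⊎_; inj₁; inj₂; [_,_])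
open import Data.Unit using (⊤; tt)
open import Data.Empty using (⊥-elim)
open import Function using (flip; _∘′_)
open import Function.Bundles using (_⤖_; Bijection)
open import Relation.Nullary using (¬_; Dec; yes; no)
open import Relation.Nullary.Decidable using (_×-dec_)
open import Relation.Binary using (tri<; tri≈; tri>)
open import Relation.Binary.PropositionalEquality using (_≡_; _≢_; refl; sym)
open import Relation.Unary using (Pred; Decidable)

-- A closed labeling matters only through the strict total order < it induces
-- on the vertices, and closedness is invariant under reversing that order.
-- Shortest paths are monotone: an interior turning point w of u – w – c would
-- be smaller (or larger) than both neighbours, and closedness would make u and c
-- adjacent. Applying closedness step by step along a monotone path from i to k
-- shows that an edge i – j with i < k < j forces the edges k – j and k – i.
-- Now let P be an increasing longest shortest path from u to v and x a vertex.
-- If x lies between two consecutive vertices of P it is adjacent to the larger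
-- one; up to reversing the order, the remaining case is v < x. The shortest path
-- from u to x is then increasing, so it either meets v or jumps over v along an
-- edge whose lower end is adjacent to v; if x is not adjacent to v, either way
-- d(u,x) > d(u,v) = diam(G), which is absurd.

module _ {p} {P : Pred ℕ p} (P? : Decidable P) where

  Least : Set p
  Least = ∃ λ m → P m × (∀ {j} → P j → m ≤ j)

  least : ∀ {k} → P k → Least
  least {k} = <-rec (λ k → P k → Least) search k
    where
      search : ∀ k → (∀ {j} → j ℕ.< k → P j → Least) → P k → Least
      search k rec Pk with anyUpTo? P? k
      ... | yes (j , j<k , Pj) = rec j<k Pj
      ... | no none = k , Pk , λ Pj → ≮⇒≥ λ j<k → none (_ , j<k , Pj)

module _ {n : ℕ} (G : SimpleGraph n) where
  open SimpleGraph G renaming (sym to Adj-sym; irrefl to Adj-irrefl; dec to Adj?)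

  private
    variable
      u v w x : Fin n
      k m : ℕ

  _∷ʳ_ : Walk G u v k → Adj v w → Walk G u w (suc k)
  here     ∷ʳ b = step b here
  step a p ∷ʳ b = step a (p ∷ʳ b)

  reverse : Walk G u v k → Walk G v u k
  reverse here       = here
  reverse (step a p) = reverse p ∷ʳ Adj-sym a

  walk? : ∀ k u v → Dec (Walk G u v k)
  walk? zero u v with u ≟ v
  ... | yes refl = yes here
  ... | no u≢v   = no λ { here → u≢v refl }
  walk? (suc k) u v with Fin.any? (λ w → Adj? u w ×-dec walk? k w v)
  ... | yes (w , a , p) = yes (step a p)
  ... | no none         = no λ { (step a p) → none (_ , a , p) }

  Geodesic : Walk G u v k → Set
  Geodesic {u} {v} {k} _ = ∀ {m} → Walk G u v m → k ≤ m

  geodesic : Connected G → ∀ u v → ∃ (Dist G u v)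
  geodesic conn u v = least (λ m → walk? m u v) (proj₂ (conn u v))

  geodesic-tail : (a : Adj u w) (p : Walk G w v k) → Geodesic (step a p) → Geodesic p
  geodesic-tail a _ geo q = ≤-pred (geo (step a q))

  end-onWalk : (p : Walk G u v k) → OnWalk G v p
  end-onWalk here       = onHead
  end-onWalk (step a p) = onTail (end-onWalk p)

  Chain : (Fin n → Fin n → Set) → Walk G u v k → Set
  Chain R here               = ⊤
  Chain R (step {u} {w} a p) = R u w × Chain R p

  adj⇒≢ : Adj u v → u ≢ v
  adj⇒≢ a refl = Adj-irrefl a

  walk-nonempty : Walk G u v k → u ≢ v → 0 ℕ.< k
  walk-nonempty here       u≢v = ⊥-elim (u≢v refl)
  walk-nonempty (step _ _) _   = s≤s z≤n

  module _ (a : Adj u w) (b : Adj w x) (q : Walk G x v k) (geo : Geodesic (step a (step b q))) where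

    geodesic-skip-≢ : u ≢ x
    geodesic-skip-≢ refl = 1+n≰n (≤-trans (n≤1+n _) (geo q))

    geodesic-skip-nonadjacent : ¬ Adj u x
    geodesic-skip-nonadjacent c = 1+n≰n (≤-pred (geo (step c q)))

  NearWalk : Fin n → Walk G u v k → Set
  NearWalk x p = OnWalk G x p ⊎ ∃ λ y → OnWalk G y p × Adj x y

  nearWalk-tail : {a : Adj u w} {p : Walk G w v k} → NearWalk x p → NearWalk x (step a p)
  nearWalk-tail = Sum.map onTail λ { (y , on , x~y) → y , onTail on , x~y }

  record ClosedOrder : Set₁ where
    field
      _≺_      : Fin n → Fin n → Set
      ≺-trans  : ∀ {a b c} → a ≺ b → b ≺ c → a ≺ c
      ≺-irrefl : ∀ {a} → ¬ a ≺ a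
      ≺-total  : ∀ {a b} → a ≢ b → a ≺ b ⊎ b ≺ a
      closed   : ∀ i j k → Adj j i → Adj i k → j ≢ k →
                 ((i ≺ j × i ≺ k) ⊎ (j ≺ i × k ≺ i)) → Adj j k

    _≼_ : Fin n → Fin n → Set
    a ≼ b = a ≡ b ⊎ a ≺ b

    ≺-asym : ∀ {a b} → a ≺ b → ¬ b ≺ a
    ≺-asym a≺b b≺a = ≺-irrefl (≺-trans a≺b b≺a)

    ≼-≺-trans : ∀ {a b c} → a ≼ b → b ≺ c → a ≺ c
    ≼-≺-trans (inj₁ refl) b≺c = b≺c
    ≼-≺-trans (inj₂ a≺b)  b≺c = ≺-trans a≺b b≺c

    ≺-≼-trans : ∀ {a b c} → a ≺ b → b ≼ c → a ≺ c
    ≺-≼-trans a≺b (inj₁ refl) = a≺b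
    ≺-≼-trans a≺b (inj₂ b≺c)  = ≺-trans a≺b b≺c

    ≼⇒⊀ : ∀ {a b} → a ≼ b → ¬ b ≺ a
    ≼⇒⊀ a≼b b≺a = ≺-irrefl (≼-≺-trans a≼b b≺a)

    ≼-total : ∀ a b → a ≼ b ⊎ b ≺ a
    ≼-total a b with a ≟ b
    ... | yes a≡b = inj₁ (inj₁ a≡b)
    ... | no a≢b  = Sum.map₁ inj₂ (≺-total a≢b)

  flipped : ClosedOrder → ClosedOrder
  flipped O = record
    { _≺_      = flip _≺_
    ; ≺-trans  = flip ≺-trans
    ; ≺-irrefl = ≺-irrefl
    ; ≺-total  = Sum.swap ∘′ ≺-total
    ; closed   = λ i j k a b j≢k → closed i j k a b j≢k ∘′ Sum.swap
    }
    where open ClosedOrder O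

  module _ (O : ClosedOrder) where
    open ClosedOrder O

    Ascending : Walk G u v k → Set
    Ascending = Chain _≺_

    ascending-≼ : (p : Walk G u v k) → Ascending p → u ≼ v
    ascending-≼ here       _           = inj₁ refl
    ascending-≼ (step a p) (u≺w , asc) = inj₂ (≺-≼-trans u≺w (ascending-≼ p asc))

    ascending-closed : (p : Walk G u v k) → Ascending p → Adj u x → v ≺ x → Adj v x
    ascending-closed here       _           u~x _   = u~x
    ascending-closed {x = x} (step {w = w} a p) (u≺w , asc) u~x v≺x =
      ascending-closed p asc (Adj-sym x~w) v≺x
      where
        w≺x : w ≺ x
        w≺x = ≼-≺-trans (ascending-≼ p asc) v≺x
        x~w : Adj x w
        x~w = closed _ x w (Adj-sym u~x) a (λ { refl → ≺-irrefl w≺x }) (inj₁ (≺-trans u≺w w≺x , u≺w))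

    geodesic-no-turn : (a : Adj u w) (b : Adj w x) (q : Walk G x v k) → Geodesic (step a (step b q)) →
                       (u ≺ w × w ≺ x) ⊎ (w ≺ u × x ≺ w)
    geodesic-no-turn {u} {w} {x} a b q geo with ≺-total (adj⇒≢ a) | ≺-total (adj⇒≢ b)
    ... | inj₁ u≺w | inj₁ w≺x = inj₁ (u≺w , w≺x)
    ... | inj₂ w≺u | inj₂ x≺w = inj₂ (w≺u , x≺w)
    ... | inj₁ u≺w | inj₂ x≺w = ⊥-elim (geodesic-skip-nonadjacent a b q geo
                                  (closed w u x a b (geodesic-skip-≢ a b q geo) (inj₂ (u≺w , x≺w))))
    ... | inj₂ w≺u | inj₁ w≺x = ⊥-elim (geodesic-skip-nonadjacent a b q geo
                                  (closed w u x a b (geodesic-skip-≢ a b q geo) (inj₁ (w≺u , w≺x))))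

    geodesic-monotone : (p : Walk G u v k) → Geodesic p → Ascending p ⊎ Chain (flip _≺_) p
    geodesic-monotone here          _ = inj₁ tt
    geodesic-monotone (step a here) _ = Sum.map (_, tt) (_, tt) (≺-total (adj⇒≢ a))
    geodesic-monotone (step a (step b q)) geo
      with geodesic-monotone (step b q) (geodesic-tail a (step b q) geo) | geodesic-no-turn a b q geo
    ... | inj₁ asc       | inj₁ (u≺w , _) = inj₁ (u≺w , asc)
    ... | inj₂ desc      | inj₂ (w≺u , _) = inj₂ (w≺u , desc)
    ... | inj₁ (w≺x , _) | inj₂ (_ , x≺w) = ⊥-elim (≺-asym w≺x x≺w)
    ... | inj₂ (x≺w , _) | inj₁ (_ , w≺x) = ⊥-elim (≺-asym w≺x x≺w)

  -- Consecutive modules with the same parameters let each one use the lemmas of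
  -- the previous ones at the reversed order.
  module _ (O : ClosedOrder) (conn : Connected G) where
    open ClosedOrder O

    interval-adjacentʳ : Adj u v → u ≺ x → x ≺ v → Adj x v
    interval-adjacentʳ {u} {v} {x} a u≺x x≺v with geodesic conn u x
    ... | _ , p , geo with geodesic-monotone O p geo
    ...   | inj₁ asc  = ascending-closed O p asc a x≺v
    ...   | inj₂ desc = ⊥-elim (ClosedOrder.≼⇒⊀ (flipped O) (ascending-≼ (flipped O) p desc) u≺x)

  module _ (O : ClosedOrder) (conn : Connected G) where
    open ClosedOrder O

    interval-adjacentˡ : Adj u v → u ≺ x → x ≺ v → Adj x u
    interval-adjacentˡ a u≺x x≺v = interval-adjacentʳ (flipped O) conn (Adj-sym a) x≺v u≺x

    ascending-shortcut : (p : Walk G u x m) → Ascending O p → u ≼ v → v ≺ x → ¬ Adj x v →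
                         ∃ λ r → Walk G u v r × r ℕ.< m
    ascending-shortcut here _ u≼v v≺x _ = ⊥-elim (≼⇒⊀ u≼v v≺x)
    ascending-shortcut (step a p) _ (inj₁ refl) _ _ = 0 , here , s≤s z≤n
    ascending-shortcut {x = x} {v = v} (step {w = w} a p) (_ , asc) (inj₂ u≺v) v≺x x≁v
      with ≼-total w v
    ... | inj₁ w≼v = let r , q , r<m = ascending-shortcut p asc w≼v v≺x x≁v in
                     suc r , step a q , s≤s r<m
    ... | inj₂ v≺w = 1 , step (Adj-sym (interval-adjacentˡ a u≺v v≺w)) here ,
                     s≤s (walk-nonempty p w≢x)
      where
        w≢x : w ≢ x
        w≢x refl = x≁v (Adj-sym (interval-adjacentʳ O conn a u≺v v≺w))

    dist-beyond : u ≼ v → v ≺ x → ¬ Adj x v → ∀ {d} → (∀ {r} → Walk G u v r → d ≤ r) →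
                  Dist G u x m → d ℕ.< m
    dist-beyond u≼v v≺x x≁v bound (p , geo) with geodesic-monotone O p geo
    ... | inj₁ asc  = let r , q , r<m = ascending-shortcut p asc u≼v v≺x x≁v in
                      <-≤-trans (s≤s (bound q)) r<m
    ... | inj₂ desc = ⊥-elim (ClosedOrder.≼⇒⊀ (flipped O) (ascending-≼ (flipped O) p desc)
                                                (≼-≺-trans u≼v v≺x))

    adjacent-beyond-diameter : u ≼ v → v ≺ x → ∀ {d} → (∀ {r} → Walk G u v r → d ≤ r) →
                               (∀ a b m → Dist G a b m → m ≤ d) → Adj x v
    adjacent-beyond-diameter {u} {v} {x} u≼v v≺x bound diam with Adj? x v
    ... | yes x~v = x~v
    ... | no x≁v  = let m , dist = geodesic conn u x in
                    ⊥-elim (<⇒≱ (dist-beyond u≼v v≺x x≁v bound dist) (diam u x m dist))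

  module _ (O : ClosedOrder) (conn : Connected G) where
    open ClosedOrder O

    ascending-locate : ∀ x (p : Walk G u v k) → Ascending O p → NearWalk x p ⊎ x ≺ u ⊎ v ≺ x
    ascending-locate {u} x here _ with ≼-total x u
    ... | inj₁ (inj₁ refl) = inj₁ (inj₁ onHead)
    ... | inj₁ (inj₂ x≺u)  = inj₂ (inj₁ x≺u)
    ... | inj₂ u≺x         = inj₂ (inj₂ u≺x)
    ascending-locate {u} x (step {w = w} a p) (u≺w , asc) with ≼-total x u
    ... | inj₁ (inj₁ refl) = inj₁ (inj₁ onHead)
    ... | inj₁ (inj₂ x≺u)  = inj₂ (inj₁ x≺u)
    ... | inj₂ u≺x with ascending-locate x p asc
    ...   | inj₁ near       = inj₁ (nearWalk-tail near)
    ...   | inj₂ (inj₁ x≺w) = inj₁ (inj₂ (w , onTail onHead , interval-adjacentʳ O conn a u≺x x≺w))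
    ...   | inj₂ (inj₂ v≺x) = inj₂ (inj₂ v≺x)

    narrow-ascending : ∀ x (p : Walk G u v k) → LongestShortestPath G p → Ascending O p →
                       NearWalk x p
    narrow-ascending {u} {v} x p (geo , _ , diam) asc with ascending-locate x p asc
    ... | inj₁ near             = near
    ... | inj₂ (inj₂ v≺x)       =
      inj₂ (v , end-onWalk p ,
            adjacent-beyond-diameter O conn (ascending-≼ O p asc) v≺x geo diam)
    ... | inj₂ (inj₁ x≺u)       =
      inj₂ (u , onHead ,
            adjacent-beyond-diameter (flipped O) conn (Sum.map₁ sym (ascending-≼ O p asc)) x≺u
                                     (geo ∘′ reverse) diam)

labelingOrder : ∀ {n} (G : SimpleGraph n) (σ : Fin n ⤖ Fin n) → IsClosedLabeling G σ → ClosedOrder G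
labelingOrder {n} G σ σ-closed = record
  { _≺_      = λ a b → ℓ a Fin.< ℓ b
  ; ≺-trans  = Fin.<-trans
  ; ≺-irrefl = Fin.<-irrefl refl
  ; ≺-total  = ≺-total
  ; closed   = σ-closed
  }
  where
    ℓ : Fin n → Fin n
    ℓ = Bijection.to σ
    ≺-total : ∀ {a b} → a ≢ b → ℓ a Fin.< ℓ b ⊎ ℓ b Fin.< ℓ a
    ≺-total {a} {b} a≢b with Fin.<-cmp (ℓ a) (ℓ b)
    ... | tri< ℓa<ℓb _ _ = inj₁ ℓa<ℓb
    ... | tri≈ _ ℓa≡ℓb _ = ⊥-elim (a≢b (Bijection.injective σ ℓa≡ℓb))
    ... | tri> _ _ ℓb<ℓa = inj₂ ℓb<ℓa

theorem2p7 : (n : ℕ) (G : SimpleGraph n) → Connected G → IsClosed G → Narrow G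
theorem2p7 n G conn (σ , σ-closed) x p lsp@(geo , _) =
  [ narrow-ascending G O conn x p lsp , narrow-ascending G (flipped G O) conn x p lsp ]
    (geodesic-monotone G O p geo)
  where O = labelingOrder G σ σ-closed
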